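{- Let $f$ be a primitive $k$-regular sequence with the data described in the context. Then for every $n\geqslant 1$, $\boldsymbol{\mu}_n={\bf A}_n\big(\delta_{1/(k^n(k-1))}\big)\,\boldsymbol{\mu}_{n-1}$, i.e. for each $i\in\{1,\ldots,d\}$, $\mu_{n,i}=\sum_{j=1}^d\frac{\varSigma_j(n-1)}{\varSigma_i(n)}\,b_{ij}\big(\delta_{1/(k^n(k-1))}\big)\ast\mu_{n-1,j}$.
   Context: Let $k\geqslant 2$ be an integer. For an integer sequence $f$ its $k$-kernel is $\ker_k(f)=\{(f(k^\ell n+r))_{n\geqslant 0}:\ell\geqslant 0,\ 0\leqslant r<k^\ell\}$; $f$ is $k$-regular if the $\mathbb{Q}$-span $\mathcal{V}_k(f)$ of $\ker_k(f)$ is finite-dimensional. Fix a basis $\{f=f_1,\ldots,f_d\}\subseteq\ker_k(f)$ of $\mathcal{V}_k(f)$ of integer sequences, put ${\bf f}(m)=(f_1(m),\ldots,f_d(m))^T$, and let ${\bf B}_a$ ($0\leqslant a\leqslant k-1$) be the $d\times d$ integer matrices with ${\bf f}(km+a)={\bf B}_a{\bf f}(m)$ for all $m\geqslant 0$; ${\bf B}=\sum_a{\bf B}_a$. $f$ is primitive if $f$ takes non-negative integer values, is not eventually zero, each ${\bf B}_a$ is entrywise non-negative and ${\bf B}$ is entrywise positive. Let $\mathbb{T}=[0,1)$ with addition mod $1$. For $n\geqslant 0$ let $\varSigma_i(n)=\sum_{m=k^n}^{k^{n+1}-1}f_i(m)$ (non-zero for primitive $f$), $\mu_{n,i}=\frac{1}{\varSigma_i(n)}\sum_{m=0}^{k^{n+1}-k^n-1}f_i(k^n+m)\,\delta_{m/(k^n(k-1))}$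 on $\mathbb{T}$ ($\delta_x$ the unit Dirac measure at $x$), and $\boldsymbol{\mu}_n=(\mu_{n,1},\ldots,\mu_{n,d})^T$. Let ${\bf B}(z)=\sum_{a=0}^{k-1}{\bf B}_az^a=(b_{ij}(z))$ and for $n\geqslant 1$ let ${\bf A}_n(z)=\big(\varSigma_j(n-1)b_{ij}(z)/\varSigma_i(n)\big)_{i,j}$. For a polynomial $p(z)=\sum_r c_rz^r$ one sets $p(\delta_x)=\sum_r c_r\delta_{rx}$ (using $(\delta_x)^r=\delta_{rx}$, the $r$-fold convolution power), and a matrix of such measures acts on a vector of measures by convolution in the usual matrix-product fashion. -}

module Defs where

open import Data.Nat as ℕ using (ℕ; zero; suc)
open import Data.Integer as ℤ using (ℤ)
open import Data.Rational as ℚ using (ℚ; 0ℚ; 1ℚ; _+_; _*_; _-_; ↧ₙ_)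
open import Data.Rational.Properties as ℚP using ()
open import Data.Fin using (Fin)
open import Data.List using (List; []; _∷_; _++_; map; concatMap; upTo)
open import Data.Product using (_×_; _,_; Σ; ∃; proj₁; proj₂)
open import Relation.Nullary using (yes; no; ¬_)
open import Relation.Binary.PropositionalEquality using (_≡_; _≢_)

∑ : ∀ {n} → (Fin n → ℚ) → ℚ
∑ {zero}  g = 0ℚ
∑ {suc n} g = g Data.Fin.zero + ∑ (λ i → g (Data.Fin.suc i))

∑ℤ : ∀ {n} → (Fin n → ℤ) → ℤ
∑ℤ {zero}  g = ℤ.0ℤ
∑ℤ {suc n} g = g Data.Fin.zero ℤ.+ ∑ℤ (λ i → g (Data.Fin.suc i))

∑range : ℕ → ℕ → (ℕ → ℚ) → ℚ
∑range a b g = Data.List.foldr _+_ 0ℚ (map (λ m → g (a ℕ.+ m)) (upTo (b ℕ.∸ a)))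

-- Conversions and a total inverse on ℚ (inverse of 0 is 0, only ever
-- applied to non-zero numbers in the statement for primitive f)

ℤ→ℚ : ℤ → ℚ
ℤ→ℚ z = z ℚ./ 1

ℕ→ℚ : ℕ → ℚ
ℕ→ℚ n = ℤ.+ n ℚ./ 1

inv : ℚ → ℚ
inv q with q ℚP.≟ 0ℚ
... | yes _ = 0ℚ
... | no q≢0 = ℚ.1/_ q {{ℚ.≢-nonZero q≢0}}

-- Finitely supported measures on 𝕋 = ℚ/ℤ-points of [0,1) with
-- rational weights: a formal finite sum  Σ w δ_x  given as a list of
-- (x , w).  Points are rationals taken modulo 1.

FMeasure : Set
FMeasure = List (ℚ × ℚ)

-- x ≡ y (mod 1)
_≡₁_ : ℚ → ℚ → Set
x ≡₁ y = ↧ₙ (x - y) ≡ 1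

massAt : FMeasure → ℚ → ℚ
massAt [] y = 0ℚ
massAt ((x , w) ∷ μ) y with ↧ₙ (x - y) ℕ.≟ 1
... | yes _ = w + massAt μ y
... | no  _ = massAt μ y

_≈ₘ_ : FMeasure → FMeasure → Set
μ ≈ₘ ν = ∀ (y : ℚ) → massAt μ y ≡ massAt ν y

δ : ℚ → FMeasure
δ x = (x , 1ℚ) ∷ []

_∗_ : FMeasure → FMeasure → FMeasure
μ ∗ ν = concatMap (λ p → map (λ q → (proj₁ p + proj₁ q , proj₂ p * proj₂ q)) ν) μ

_·ₘ_ : ℚ → FMeasure → FMeasure
c ·ₘ μ = map (λ p → (proj₁ p , c * proj₂ p)) μ

∑ₘ : ∀ {n} → (Fin n → FMeasure) → FMeasure
∑ₘ {zero}  g = []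
∑ₘ {suc n} g = g Data.Fin.zero ++ ∑ₘ (λ i → g (Data.Fin.suc i))

-- p(δ_x) = Σ_r c_r δ_{r x} for the polynomial p(z) = Σ_{r<k} c_r z^r
polyδ : ∀ {k} → (Fin k → ℤ) → ℚ → FMeasure
polyδ {k} c x = ∑ₘ (λ r → (ℕ→ℚ (Data.Fin.toℕ r) * x , ℤ→ℚ (c r)) ∷ [])

module _ (k : ℕ) where

  InKernel : (ℕ → ℤ) → (ℕ → ℤ) → Set
  InKernel f g = Σ ℕ λ ℓ → Σ ℕ λ r → (r ℕ.< k ℕ.^ ℓ) × (∀ n → g n ≡ f (k ℕ.^ ℓ ℕ.* n ℕ.+ r))

  IsKernelBasis : ∀ {d} → (ℕ → ℤ) → (Fin d → ℕ → ℤ) → Set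
  IsKernelBasis {d} f F =
      (∀ i → InKernel f (F i))
    × (∀ g → InKernel f g → Σ (Fin d → ℚ) λ c → ∀ n → ℤ→ℚ (g n) ≡ ∑ (λ i → c i * ℤ→ℚ (F i n)))
    × (∀ (c : Fin d → ℚ) → (∀ n → ∑ (λ i → c i * ℤ→ℚ (F i n)) ≡ 0ℚ) → ∀ i → c i ≡ 0ℚ)

  IsRepresentation : ∀ {d} → (Fin d → ℕ → ℤ) → (Fin k → Fin d → Fin d → ℤ) → Set
  IsRepresentation {d} F B = ∀ (a : Fin k) (m : ℕ) (i : Fin d) →
    F i (k ℕ.* m ℕ.+ Data.Fin.toℕ a) ≡ ∑ℤ (λ j → B a i j ℤ.* F j m)

  IsPrimitive : ∀ {d} → (ℕ → ℤ) → (Fin k → Fin d → Fin d → ℤ) → Set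
  IsPrimitive {d} f B =
      (∀ n → ℤ.0ℤ ℤ.≤ f n)
    × (∀ N → Σ ℕ λ n → (N ℕ.≤ n) × (f n ≢ ℤ.0ℤ))
    × (∀ a i j → ℤ.0ℤ ℤ.≤ B a i j)
    × (∀ i j → ℤ.0ℤ ℤ.< ∑ℤ (λ a → B a i j))

  module _ {d : ℕ} (F : Fin d → ℕ → ℤ) (B : Fin k → Fin d → Fin d → ℤ) where

    Sig : Fin d → ℕ → ℚ
    Sig i n = ∑range (k ℕ.^ n) (k ℕ.^ suc n) (λ m → ℤ→ℚ (F i m))

    μ : ℕ → Fin d → FMeasure
    μ n i = map (λ m → ( ℕ→ℚ m * inv (ℕ→ℚ (k ℕ.^ n ℕ.* (k ℕ.∸ 1)))
                       , inv (Sig i n) * ℤ→ℚ (F i (k ℕ.^ n ℕ.+ m)) ))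
                (upTo (k ℕ.^ suc n ℕ.∸ k ℕ.^ n))

    -- ( A_n(δ_x) μ_{n-1} )_i = Σ_j (Σ_j(n-1)/Σ_i(n)) b_ij(δ_x) ∗ μ_{n-1,j},
    -- with b_ij(z) = Σ_a (B_a)_ij z^a, evaluated at x = 1/(k^n(k-1))
    Aμ : ℕ → Fin d → FMeasure
    Aμ n i = ∑ₘ (λ j → (Sig j (n ℕ.∸ 1) * inv (Sig i n)) ·ₘ
                        (polyδ (λ a → B a i j) x ∗ μ (n ℕ.∸ 1) j))
      where x = inv (ℕ→ℚ (k ℕ.^ n ℕ.* (k ℕ.∸ 1)))

-- Write m = t k + a with 0 ≤ a < k. The atom of μ_{n,i} at m/(k^n(k-1)) has weight
-- f_i(k(k^{n-1}+t)+a)/Σ_i(n) = Σ_j (B_a)_{ij} f_j(k^{n-1}+t)/Σ_i(n), and its position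
-- a/(k^n(k-1)) + t/(k^{n-1}(k-1)) is that of the t-th atom of μ_{n-1,j} translated by
-- the a-th atom of b_ij(δ_{1/(k^n(k-1))}). So both measures give every point the same
-- triple sum over t, a and j, taken in different orders.
module Submission where

open import Defs
open import Data.Nat using (ℕ; suc; _≤_)
open import Data.Integer using (ℤ)
open import Data.Fin using (Fin; zero)

open import Algebra.Bundles using (CommutativeMonoid)
import Algebra.Properties.CommutativeSemigroup as CommSemigroupProperties
open import Data.Nat as ℕ using (zero; _^_; _∸_; NonZero)
import Data.Nat.Properties as ℕP
open import Data.Integer as ℤ using (0ℤ)
import Data.Integer.Properties as ℤP
open import Data.Rational as ℚ using (ℚ; 0ℚ; 1ℚ; _+_; _*_; ↧ₙ_; _-_)
import Data.Rational.Properties as ℚP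
open import Data.Rational.Solver using (module +-*-Solver)
import Data.Rational.Unnormalised as ℚᵘ
import Data.Rational.Unnormalised.Properties as ℚᵘP
open import Data.Fin using (toℕ) renaming (suc to fsuc)
open import Data.List using ([]; _∷_; _++_; map; foldr; applyUpTo; upTo)
open import Data.List.Properties using (map-applyUpTo; map-∘; concatMap-++; ++-identityʳ)
open import Data.Product using (_×_; _,_; proj₁; proj₂)
open import Data.Empty using (⊥-elim)
open import Function using (_∘_; case_of_)
open import Relation.Nullary using (yes; no)
open import Relation.Binary.PropositionalEquality
open ≡-Reasoning

open CommSemigroupProperties (CommutativeMonoid.commutativeSemigroup ℚP.+-0-commutativeMonoid)
  using () renaming (interchange to +-interchange)

∑-cong : ∀ {n} {g h : Fin n → ℚ} → (∀ i → g i ≡ h i) → ∑ g ≡ ∑ h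
∑-cong {zero}  _   = refl
∑-cong {suc n} g≗h = cong₂ _+_ (g≗h zero) (∑-cong (g≗h ∘ fsuc))

∑-zero : ∀ n → ∑ {n} (λ _ → 0ℚ) ≡ 0ℚ
∑-zero zero    = refl
∑-zero (suc n) = trans (ℚP.+-identityˡ _) (∑-zero n)

∑-distrib-+ : ∀ {n} (g h : Fin n → ℚ) → ∑ (λ i → g i + h i) ≡ ∑ g + ∑ h
∑-distrib-+ {zero}  g h = refl
∑-distrib-+ {suc n} g h = trans
  (cong (g zero + h zero +_) (∑-distrib-+ (g ∘ fsuc) (h ∘ fsuc)))
  (+-interchange (g zero) (h zero) _ _)

∑-comm : ∀ {m n} (g : Fin m → Fin n → ℚ) →
         ∑ (λ i → ∑ (g i)) ≡ ∑ (λ j → ∑ (λ i → g i j))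
∑-comm {zero}  {n} g = sym (∑-zero n)
∑-comm {suc m}     g = trans
  (cong (∑ (g zero) +_) (∑-comm (g ∘ fsuc)))
  (sym (∑-distrib-+ (g zero) _))

*-distribˡ-∑ : ∀ {n} c (g : Fin n → ℚ) → c * ∑ g ≡ ∑ (λ i → c * g i)
*-distribˡ-∑ {zero}  c g = ℚP.*-zeroʳ c
*-distribˡ-∑ {suc n} c g = trans
  (ℚP.*-distribˡ-+ c (g zero) _)
  (cong (c * g zero +_) (*-distribˡ-∑ c (g ∘ fsuc)))

*-distribʳ-∑ : ∀ {n} c (g : Fin n → ℚ) → ∑ g * c ≡ ∑ (λ i → g i * c)
*-distribʳ-∑ c g = trans (ℚP.*-comm _ c)
  (trans (*-distribˡ-∑ c g) (∑-cong (λ i → ℚP.*-comm c (g i))))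

∑-rotate₃ : ∀ {l m n} (g : Fin l → Fin m → Fin n → ℚ) →
            ∑ (λ t → ∑ (λ a → ∑ (λ j → g t a j))) ≡ ∑ (λ j → ∑ (λ a → ∑ (λ t → g t a j)))
∑-rotate₃ g = begin
  ∑ (λ t → ∑ (λ a → ∑ (λ j → g t a j))) ≡⟨ ∑-cong (λ t → ∑-comm (g t)) ⟩
  ∑ (λ t → ∑ (λ j → ∑ (λ a → g t a j))) ≡⟨ ∑-comm (λ t j → ∑ (λ a → g t a j)) ⟩
  ∑ (λ j → ∑ (λ t → ∑ (λ a → g t a j))) ≡⟨ ∑-cong (λ j → ∑-comm (λ t a → g t a j)) ⟩
  ∑ (λ j → ∑ (λ a → ∑ (λ t → g t a j))) ∎

∑< : ℕ → (ℕ → ℚ) → ℚ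
∑< n h = ∑ {n} (h ∘ toℕ)

∑<-+ : ∀ m n (h : ℕ → ℚ) → ∑< (m ℕ.+ n) h ≡ ∑< m h + ∑< n (h ∘ (m ℕ.+_))
∑<-+ zero    n h = sym (ℚP.+-identityˡ _)
∑<-+ (suc m) n h = trans (cong (h 0 +_) (∑<-+ m n (h ∘ suc))) (sym (ℚP.+-assoc (h 0) _ _))

∑<-* : ∀ m n (h : ℕ → ℚ) → ∑< (m ℕ.* n) h ≡ ∑< m (λ t → ∑ {n} (λ a → h (t ℕ.* n ℕ.+ toℕ a)))
∑<-* zero    n h = refl
∑<-* (suc m) n h = begin
  ∑< (n ℕ.+ m ℕ.* n) h
    ≡⟨ ∑<-+ n (m ℕ.* n) h ⟩
  ∑< n h + ∑< (m ℕ.* n) (h ∘ (n ℕ.+_))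
    ≡⟨ cong (∑< n h +_) (∑<-* m n (h ∘ (n ℕ.+_))) ⟩
  ∑< n h + ∑< m (λ t → ∑ {n} (λ a → h (n ℕ.+ (t ℕ.* n ℕ.+ toℕ a))))
    ≡⟨ cong (∑< n h +_) (∑-cong {m} (λ t → ∑-cong {n} (λ a →
         cong h (sym (ℕP.+-assoc n (toℕ t ℕ.* n) (toℕ a)))))) ⟩
  ∑< (suc m) (λ t → ∑ {n} (λ a → h (t ℕ.* n ℕ.+ toℕ a))) ∎

foldr-applyUpTo : ∀ n (f : ℕ → ℚ) → foldr _+_ 0ℚ (applyUpTo f n) ≡ ∑< n f
foldr-applyUpTo zero    f = refl
foldr-applyUpTo (suc n) f = cong (f 0 +_) (foldr-applyUpTo n (f ∘ suc))

fromℚᵘ-homo-+ : ∀ p q → ℚ.fromℚᵘ (p ℚᵘ.+ q) ≡ ℚ.fromℚᵘ p + ℚ.fromℚᵘ q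
fromℚᵘ-homo-+ p q = ℚP.toℚᵘ-injective (ℚᵘP.≃-trans (ℚP.toℚᵘ-fromℚᵘ (p ℚᵘ.+ q))
  (ℚᵘP.≃-sym (ℚᵘP.≃-trans (ℚP.toℚᵘ-homo-+ (ℚ.fromℚᵘ p) (ℚ.fromℚᵘ q))
    (ℚᵘP.+-cong (ℚP.toℚᵘ-fromℚᵘ p) (ℚP.toℚᵘ-fromℚᵘ q)))))

fromℚᵘ-homo-* : ∀ p q → ℚ.fromℚᵘ (p ℚᵘ.* q) ≡ ℚ.fromℚᵘ p * ℚ.fromℚᵘ q
fromℚᵘ-homo-* p q = ℚP.toℚᵘ-injective (ℚᵘP.≃-trans (ℚP.toℚᵘ-fromℚᵘ (p ℚᵘ.* q))
  (ℚᵘP.≃-sym (ℚᵘP.≃-trans (ℚP.toℚᵘ-homo-* (ℚ.fromℚᵘ p) (ℚ.fromℚᵘ q))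
    (ℚᵘP.*-cong (ℚP.toℚᵘ-fromℚᵘ p) (ℚP.toℚᵘ-fromℚᵘ q)))))

ℤ→ℚ-+ : ∀ a b → ℤ→ℚ (a ℤ.+ b) ≡ ℤ→ℚ a + ℤ→ℚ b
ℤ→ℚ-+ a b = trans
  (ℚP.fromℚᵘ-cong {ℚᵘ.mkℚᵘ (a ℤ.+ b) 0} {ℚᵘ.mkℚᵘ a 0 ℚᵘ.+ ℚᵘ.mkℚᵘ b 0} (ℚᵘ.*≡* same-numerator))
  (fromℚᵘ-homo-+ (ℚᵘ.mkℚᵘ a 0) (ℚᵘ.mkℚᵘ b 0))
  where
  same-numerator : (a ℤ.+ b) ℤ.* ℤ.+ 1 ≡ (a ℤ.* ℤ.+ 1 ℤ.+ b ℤ.* ℤ.+ 1) ℤ.* ℤ.+ 1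
  same-numerator = cong (ℤ._* ℤ.+ 1) (sym (cong₂ ℤ._+_ (ℤP.*-identityʳ a) (ℤP.*-identityʳ b)))

ℤ→ℚ-* : ∀ a b → ℤ→ℚ (a ℤ.* b) ≡ ℤ→ℚ a * ℤ→ℚ b
ℤ→ℚ-* a b = fromℚᵘ-homo-* (ℚᵘ.mkℚᵘ a 0) (ℚᵘ.mkℚᵘ b 0)

ℤ→ℚ-injective : ∀ {a b} → ℤ→ℚ a ≡ ℤ→ℚ b → a ≡ b
ℤ→ℚ-injective {a} {b} eq with ℚP.fromℚᵘ-injective {ℚᵘ.mkℚᵘ a 0} {ℚᵘ.mkℚᵘ b 0} eq
... | ℚᵘ.*≡* a*1≡b*1 = trans (sym (ℤP.*-identityʳ a)) (trans a*1≡b*1 (ℤP.*-identityʳ b))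

ℤ→ℚ-∑ℤ : ∀ {n} (g : Fin n → ℤ) → ℤ→ℚ (∑ℤ g) ≡ ∑ (ℤ→ℚ ∘ g)
ℤ→ℚ-∑ℤ {zero}  g = refl
ℤ→ℚ-∑ℤ {suc n} g = trans (ℤ→ℚ-+ (g zero) _) (cong (ℤ→ℚ (g zero) +_) (ℤ→ℚ-∑ℤ (g ∘ fsuc)))

ℕ→ℚ-+ : ∀ m n → ℕ→ℚ (m ℕ.+ n) ≡ ℕ→ℚ m + ℕ→ℚ n
ℕ→ℚ-+ m n = ℤ→ℚ-+ (ℤ.+ m) (ℤ.+ n)

ℕ→ℚ-* : ∀ m n → ℕ→ℚ (m ℕ.* n) ≡ ℕ→ℚ m * ℕ→ℚ n
ℕ→ℚ-* m n = trans (cong ℤ→ℚ (ℤP.pos-* m n)) (ℤ→ℚ-* (ℤ.+ m) (ℤ.+ n))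

ℕ→ℚ-nonZero : ∀ n .{{_ : NonZero n}} → ℕ→ℚ n ≢ 0ℚ
ℕ→ℚ-nonZero (suc n) eq with ℤ→ℚ-injective {ℤ.+ suc n} {0ℤ} eq
... | ()

∑ℤ-nonNeg : ∀ {n} (g : Fin n → ℤ) → (∀ t → 0ℤ ℤ.≤ g t) → 0ℤ ℤ.≤ ∑ℤ g
∑ℤ-nonNeg {zero}  g _   = ℤP.≤-refl
∑ℤ-nonNeg {suc n} g g≥0 = ℤP.+-mono-≤ (g≥0 zero) (∑ℤ-nonNeg (g ∘ fsuc) (g≥0 ∘ fsuc))

nonNeg-+-≡0 : ∀ {a b} → 0ℤ ℤ.≤ a → 0ℤ ℤ.≤ b → a ℤ.+ b ≡ 0ℤ → a ≡ 0ℤ × b ≡ 0ℤ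
nonNeg-+-≡0 {ℤ.+ m} (ℤ.+≤+ _) (ℤ.+≤+ _) a+b≡0 =
    cong ℤ.+_ (ℕP.m+n≡0⇒m≡0 m (ℤP.+-injective a+b≡0))
  , cong ℤ.+_ (ℕP.m+n≡0⇒n≡0 m (ℤP.+-injective a+b≡0))

∑ℤ-nonNeg-≡0 : ∀ {n} (g : Fin n → ℤ) → (∀ t → 0ℤ ℤ.≤ g t) → ∑ℤ g ≡ 0ℤ → ∀ t → g t ≡ 0ℤ
∑ℤ-nonNeg-≡0 {suc n} g g≥0 sum≡0 = λ where
    zero     → proj₁ head-and-tail≡0
    (fsuc t) → ∑ℤ-nonNeg-≡0 (g ∘ fsuc) (g≥0 ∘ fsuc) (proj₂ head-and-tail≡0) t
  where
  head-and-tail≡0 : g zero ≡ 0ℤ × ∑ℤ (g ∘ fsuc) ≡ 0ℤ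
  head-and-tail≡0 = nonNeg-+-≡0 (g≥0 zero) (∑ℤ-nonNeg (g ∘ fsuc) (g≥0 ∘ fsuc)) sum≡0

*-inv : ∀ q → q ≢ 0ℚ → q * inv q ≡ 1ℚ
*-inv q q≢0 with q ℚP.≟ 0ℚ
... | yes q≡0 = ⊥-elim (q≢0 q≡0)
... | no  q≢0 = ℚP.*-inverseʳ q {{ℚ.≢-nonZero q≢0}}

-- Valid even for s = 0 (where inv s = 0), provided w vanishes along with s.
*-inv-cancelˡ : ∀ s w → (s ≡ 0ℚ → w ≡ 0ℚ) → s * inv s * w ≡ w
*-inv-cancelˡ s w s≡0⇒w≡0 = case s ℚP.≟ 0ℚ of λ where
  (yes s≡0) → trans (cong (s * inv s *_) (s≡0⇒w≡0 s≡0))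
                    (trans (ℚP.*-zeroʳ (s * inv s)) (sym (s≡0⇒w≡0 s≡0)))
  (no  s≢0) → trans (cong (_* w) (*-inv s s≢0)) (ℚP.*-identityˡ w)

inv-ℕ→ℚ-* : ∀ m n .{{_ : NonZero m}} .{{_ : NonZero n}} →
            inv (ℕ→ℚ n) ≡ ℕ→ℚ m * inv (ℕ→ℚ (m ℕ.* n))
inv-ℕ→ℚ-* m n = begin
  inv N                    ≡⟨ sym (ℚP.*-identityʳ (inv N)) ⟩
  inv N * 1ℚ               ≡⟨ cong (inv N *_) (sym (*-inv MN (ℕ→ℚ-nonZero (m ℕ.* n) {{ℕP.m*n≢0 m n}}))) ⟩
  inv N * (MN * inv MN)    ≡⟨ cong (λ z → inv N * (z * inv MN)) (ℕ→ℚ-* m n) ⟩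
  inv N * (M * N * inv MN) ≡⟨ solve 4 (λ N⁻¹ M N MN⁻¹ → N⁻¹ :* (M :* N :* MN⁻¹) := M :* (N :* N⁻¹) :* MN⁻¹)
                                      refl (inv N) M N (inv MN) ⟩
  M * (N * inv N) * inv MN ≡⟨ cong (λ z → M * z * inv MN) (*-inv N (ℕ→ℚ-nonZero n)) ⟩
  M * 1ℚ * inv MN          ≡⟨ cong (_* inv MN) (ℚP.*-identityʳ M) ⟩
  M * inv MN               ∎
  where
  open +-*-Solver
  M N MN : ℚ
  M = ℕ→ℚ m
  N = ℕ→ℚ n
  MN = ℕ→ℚ (m ℕ.* n)

δ-mass : ℚ → ℚ → ℚ
δ-mass x y with ↧ₙ (x - y) ℕ.≟ 1
... | yes _ = 1ℚ
... | no  _ = 0ℚ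

atomMass : ℚ × ℚ → ℚ → ℚ
atomMass (x , w) y = w * δ-mass x y

massAt-∷ : ∀ p ν y → massAt (p ∷ ν) y ≡ atomMass p y + massAt ν y
massAt-∷ (x , w) ν y with ↧ₙ (x - y) ℕ.≟ 1
... | yes _ = cong (_+ massAt ν y) (sym (ℚP.*-identityʳ w))
... | no  _ = sym (trans (cong (_+ massAt ν y) (ℚP.*-zeroʳ w)) (ℚP.+-identityˡ _))

massAt-++ : ∀ μ ν y → massAt (μ ++ ν) y ≡ massAt μ y + massAt ν y
massAt-++ []      ν y = sym (ℚP.+-identityˡ _)
massAt-++ (p ∷ μ) ν y = begin
  massAt (p ∷ μ ++ ν) y                      ≡⟨ massAt-∷ p (μ ++ ν) y ⟩
  atomMass p y + massAt (μ ++ ν) y           ≡⟨ cong (atomMass p y +_) (massAt-++ μ ν y) ⟩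
  atomMass p y + (massAt μ y + massAt ν y)   ≡⟨ sym (ℚP.+-assoc (atomMass p y) _ _) ⟩
  atomMass p y + massAt μ y + massAt ν y     ≡⟨ cong (_+ massAt ν y) (sym (massAt-∷ p μ y)) ⟩
  massAt (p ∷ μ) y + massAt ν y              ∎

massAt-·ₘ : ∀ c μ y → massAt (c ·ₘ μ) y ≡ c * massAt μ y
massAt-·ₘ c []            y = sym (ℚP.*-zeroʳ c)
massAt-·ₘ c ((x , w) ∷ μ) y = begin
  massAt ((x , c * w) ∷ c ·ₘ μ) y                ≡⟨ massAt-∷ (x , c * w) (c ·ₘ μ) y ⟩
  c * w * δ-mass x y + massAt (c ·ₘ μ) y         ≡⟨ cong₂ _+_ (ℚP.*-assoc c w _) (massAt-·ₘ c μ y) ⟩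
  c * (w * δ-mass x y) + c * massAt μ y          ≡⟨ sym (ℚP.*-distribˡ-+ c _ _) ⟩
  c * (w * δ-mass x y + massAt μ y)              ≡⟨ cong (c *_) (sym (massAt-∷ (x , w) μ y)) ⟩
  c * massAt ((x , w) ∷ μ) y                     ∎

massAt-∑ₘ : ∀ {n} (g : Fin n → FMeasure) y → massAt (∑ₘ g) y ≡ ∑ (λ j → massAt (g j) y)
massAt-∑ₘ {zero}  g y = refl
massAt-∑ₘ {suc n} g y = trans (massAt-++ (g zero) _ y) (cong (massAt (g zero) y +_) (massAt-∑ₘ (g ∘ fsuc) y))

massAt-applyUpTo : ∀ n (f : ℕ → ℚ × ℚ) y → massAt (applyUpTo f n) y ≡ ∑< n (λ m → atomMass (f m) y)
massAt-applyUpTo zero    f y = refl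
massAt-applyUpTo (suc n) f y = trans (massAt-∷ (f 0) _ y) (cong (atomMass (f 0) y +_) (massAt-applyUpTo n (f ∘ suc) y))

massAt-map-upTo : ∀ n (f : ℕ → ℚ × ℚ) y → massAt (map f (upTo n)) y ≡ ∑< n (λ m → atomMass (f m) y)
massAt-map-upTo n f y = trans (cong (λ ν → massAt ν y) (map-applyUpTo (λ m → m) f n)) (massAt-applyUpTo n f y)

translate : ℚ × ℚ → ℚ × ℚ → ℚ × ℚ
translate (x , v) (x′ , w) = (x + x′ , v * w)

∑ₘ-∗ : ∀ {n} (g : Fin n → FMeasure) ν → ∑ₘ g ∗ ν ≡ ∑ₘ (λ r → g r ∗ ν)
∑ₘ-∗ {zero}  g ν = refl
∑ₘ-∗ {suc n} g ν = trans (concatMap-++ _ (g zero) (∑ₘ (g ∘ fsuc)))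
                          (cong (g zero ∗ ν ++_) (∑ₘ-∗ (g ∘ fsuc) ν))

massAt-polyδ-∗ : ∀ {k} (c : Fin k → ℤ) x ν y →
  massAt (polyδ c x ∗ ν) y ≡ ∑ (λ r → massAt (map (translate (ℕ→ℚ (toℕ r) * x , ℤ→ℚ (c r))) ν) y)
massAt-polyδ-∗ {k} c x ν y = begin
  massAt (polyδ c x ∗ ν) y
    ≡⟨ cong (λ μ → massAt μ y) (∑ₘ-∗ (λ r → point r ∷ []) ν) ⟩
  massAt (∑ₘ (λ r → (point r ∷ []) ∗ ν)) y
    ≡⟨ massAt-∑ₘ (λ r → (point r ∷ []) ∗ ν) y ⟩
  ∑ (λ r → massAt (map (translate (point r)) ν ++ []) y)
    ≡⟨ ∑-cong (λ r → cong (λ μ → massAt μ y) (++-identityʳ (map (translate (point r)) ν))) ⟩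
  ∑ (λ r → massAt (map (translate (point r)) ν) y) ∎
  where
  point : Fin k → ℚ × ℚ
  point r = (ℕ→ℚ (toℕ r) * x , ℤ→ℚ (c r))

kernel-nonNeg : ∀ {k f g} → InKernel k f g → (∀ n → 0ℤ ℤ.≤ f n) → ∀ n → 0ℤ ℤ.≤ g n
kernel-nonNeg (_ , _ , _ , g≡f∘affine) f≥0 n = subst (0ℤ ℤ.≤_) (sym (g≡f∘affine n)) (f≥0 _)

module Measures (k : ℕ) (2≤k : 2 ≤ k) {d : ℕ}
                (F : Fin d → ℕ → ℤ) (B : Fin k → Fin d → Fin d → ℤ) where

  private instance
    k≢0   : NonZero k
    k≢0   = ℕ.>-nonZero (ℕP.≤-trans (ℕ.s≤s ℕ.z≤n) 2≤k)
    k-1≢0 : NonZero (k ∸ 1)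
    k-1≢0 = ℕ.>-nonZero (ℕP.∸-monoˡ-≤ 1 2≤k)

  blockLength : ℕ → ℕ
  blockLength n = k ^ suc n ∸ k ^ n

  blockLength-suc : ∀ n → blockLength (suc n) ≡ blockLength n ℕ.* k
  blockLength-suc n = trans (sym (ℕP.*-distribˡ-∸ k (k ^ suc n) (k ^ n))) (ℕP.*-comm k _)

  spacing : ℕ → ℚ
  spacing n = inv (ℕ→ℚ (k ^ n ℕ.* (k ∸ 1)))

  spacing-suc : ∀ n → spacing n ≡ ℕ→ℚ k * spacing (suc n)
  spacing-suc n = trans
    (inv-ℕ→ℚ-* k (k ^ n ℕ.* (k ∸ 1)) {{k≢0}} {{ℕP.m*n≢0 (k ^ n) (k ∸ 1) {{ℕP.m^n≢0 k n}}}})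
    (cong (λ m → ℕ→ℚ k * inv (ℕ→ℚ m)) (sym (ℕP.*-assoc k (k ^ n) (k ∸ 1))))

  -- μ k F B n i is definitionally map (atom n i) (upTo (blockLength n)).
  atom : ℕ → Fin d → ℕ → ℚ × ℚ
  atom n i m = (ℕ→ℚ m * spacing n , inv (Sig k F B i n) * ℤ→ℚ (F i (k ^ n ℕ.+ m)))

  massAt-map-μ : ∀ n j (f : ℚ × ℚ → ℚ × ℚ) y →
    massAt (map f (μ k F B n j)) y ≡ ∑< (blockLength n) (λ m → atomMass (f (atom n j m)) y)
  massAt-map-μ n j f y = trans (cong (λ ν → massAt ν y) (sym (map-∘ (upTo (blockLength n)))))
                               (massAt-map-upTo (blockLength n) (f ∘ atom n j) y)

  Sig-∑ℤ : ∀ i n → Sig k F B i n ≡ ℤ→ℚ (∑ℤ {blockLength n} (λ t → F i (k ^ n ℕ.+ toℕ t)))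
  Sig-∑ℤ i n = begin
    foldr _+_ 0ℚ (map (λ m → ℤ→ℚ (F i (k ^ n ℕ.+ m))) (upTo (blockLength n)))
      ≡⟨ cong (foldr _+_ 0ℚ) (map-applyUpTo (λ m → m) _ (blockLength n)) ⟩
    foldr _+_ 0ℚ (applyUpTo (λ m → ℤ→ℚ (F i (k ^ n ℕ.+ m))) (blockLength n))
      ≡⟨ foldr-applyUpTo (blockLength n) (λ m → ℤ→ℚ (F i (k ^ n ℕ.+ m))) ⟩
    ∑< (blockLength n) (λ m → ℤ→ℚ (F i (k ^ n ℕ.+ m)))
      ≡⟨ sym (ℤ→ℚ-∑ℤ {blockLength n} (λ t → F i (k ^ n ℕ.+ toℕ t))) ⟩
    ℤ→ℚ (∑ℤ {blockLength n} (λ t → F i (k ^ n ℕ.+ toℕ t))) ∎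

  Sig≡0⇒block≡0 : (∀ i m → 0ℤ ℤ.≤ F i m) → ∀ i n → Sig k F B i n ≡ 0ℚ →
                   ∀ (t : Fin (blockLength n)) → ℤ→ℚ (F i (k ^ n ℕ.+ toℕ t)) ≡ 0ℚ
  Sig≡0⇒block≡0 F≥0 i n Sig≡0 = cong ℤ→ℚ ∘
    ∑ℤ-nonNeg-≡0 {blockLength n} (λ t → F i (k ^ n ℕ.+ toℕ t)) (λ t → F≥0 i _)
                 (ℤ→ℚ-injective (trans (sym (Sig-∑ℤ i n)) Sig≡0))

  -- The scalar factor of the (i, j) entry of A_{n+1}.
  ratio : ℕ → Fin d → Fin d → ℚ
  ratio n i j = Sig k F B j n * inv (Sig k F B i (suc n))

  polyAtom : ℕ → Fin d → Fin d → Fin k → ℚ × ℚ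
  polyAtom n i j a = (ℕ→ℚ (toℕ a) * spacing n , ℤ→ℚ (B a i j))

  contribution : ℕ → Fin d → ℚ → Fin d → Fin k → ℕ → ℚ
  contribution n i y j a t = ratio n i j * atomMass (translate (polyAtom (suc n) i j a) (atom n j t)) y

  atom-position : ∀ n t a → ℕ→ℚ (t ℕ.* k ℕ.+ a) * spacing (suc n) ≡
                            ℕ→ℚ a * spacing (suc n) + ℕ→ℚ t * spacing n
  atom-position n t a = begin
    ℕ→ℚ (t ℕ.* k ℕ.+ a) * s
      ≡⟨ cong (_* s) (trans (ℕ→ℚ-+ (t ℕ.* k) a) (cong (_+ A) (ℕ→ℚ-* t k))) ⟩
    (T * K + A) * s
      ≡⟨ solve 4 (λ T K A s → (T :* K :+ A) :* s := A :* s :+ T :* (K :* s)) refl T K A s ⟩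
    A * s + T * (K * s)
      ≡⟨ cong (λ z → A * s + T * z) (sym (spacing-suc n)) ⟩
    A * s + T * spacing n ∎
    where
    open +-*-Solver
    s T K A : ℚ
    s = spacing (suc n)
    T = ℕ→ℚ t
    K = ℕ→ℚ k
    A = ℕ→ℚ a

  atom-index : ∀ n t a → k ^ suc n ℕ.+ (t ℕ.* k ℕ.+ a) ≡ k ℕ.* (k ^ n ℕ.+ t) ℕ.+ a
  atom-index n t a = begin
    k ℕ.* k ^ n ℕ.+ (t ℕ.* k ℕ.+ a) ≡⟨ cong (λ z → k ℕ.* k ^ n ℕ.+ (z ℕ.+ a)) (ℕP.*-comm t k) ⟩
    k ℕ.* k ^ n ℕ.+ (k ℕ.* t ℕ.+ a) ≡⟨ sym (ℕP.+-assoc (k ℕ.* k ^ n) (k ℕ.* t) a) ⟩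
    k ℕ.* k ^ n ℕ.+ k ℕ.* t ℕ.+ a   ≡⟨ cong (ℕ._+ a) (sym (ℕP.*-distribˡ-+ k (k ^ n) t)) ⟩
    k ℕ.* (k ^ n ℕ.+ t) ℕ.+ a       ∎

  -- Normalising the inner weight by Σ_j(n) and undoing it is harmless even when
  -- Σ_j(n) = 0, since then the whole block of f_j vanishes.
  atom-weight : IsRepresentation k F B → (∀ i m → 0ℤ ℤ.≤ F i m) →
    ∀ n i (t : Fin (blockLength n)) (a : Fin k) →
    proj₂ (atom (suc n) i (toℕ t ℕ.* k ℕ.+ toℕ a)) ≡
    ∑ (λ j → ratio n i j * (ℤ→ℚ (B a i j) * proj₂ (atom n j (toℕ t))))
  atom-weight rep F≥0 n i t a = begin
    σᵢ⁻¹ * ℤ→ℚ (F i (k ^ suc n ℕ.+ (toℕ t ℕ.* k ℕ.+ toℕ a)))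
      ≡⟨ cong (λ m → σᵢ⁻¹ * ℤ→ℚ (F i m)) (atom-index n (toℕ t) (toℕ a)) ⟩
    σᵢ⁻¹ * ℤ→ℚ (F i (k ℕ.* (k ^ n ℕ.+ toℕ t) ℕ.+ toℕ a))
      ≡⟨ cong (λ z → σᵢ⁻¹ * ℤ→ℚ z) (rep a (k ^ n ℕ.+ toℕ t) i) ⟩
    σᵢ⁻¹ * ℤ→ℚ (∑ℤ (λ j → B a i j ℤ.* f j))
      ≡⟨ cong (σᵢ⁻¹ *_) (ℤ→ℚ-∑ℤ (λ j → B a i j ℤ.* f j)) ⟩
    σᵢ⁻¹ * ∑ (λ j → ℤ→ℚ (B a i j ℤ.* f j))
      ≡⟨ *-distribˡ-∑ σᵢ⁻¹ (λ j → ℤ→ℚ (B a i j ℤ.* f j)) ⟩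
    ∑ (λ j → σᵢ⁻¹ * ℤ→ℚ (B a i j ℤ.* f j))
      ≡⟨ ∑-cong summand ⟩
    ∑ (λ j → ratio n i j * (ℤ→ℚ (B a i j) * (inv (σ j) * ℤ→ℚ (f j)))) ∎
    where
    open +-*-Solver
    σ : Fin d → ℚ
    σ j = Sig k F B j n
    σᵢ⁻¹ : ℚ
    σᵢ⁻¹ = inv (Sig k F B i (suc n))
    f : Fin d → ℤ
    f j = F j (k ^ n ℕ.+ toℕ t)

    summand : ∀ j → σᵢ⁻¹ * ℤ→ℚ (B a i j ℤ.* f j) ≡
                    ratio n i j * (ℤ→ℚ (B a i j) * (inv (σ j) * ℤ→ℚ (f j)))
    summand j = begin
      σᵢ⁻¹ * ℤ→ℚ (B a i j ℤ.* f j)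
        ≡⟨ cong (σᵢ⁻¹ *_) (ℤ→ℚ-* (B a i j) (f j)) ⟩
      σᵢ⁻¹ * (b * ℤ→ℚ (f j))
        ≡⟨ cong (λ z → σᵢ⁻¹ * (b * z))
             (sym (*-inv-cancelˡ (σ j) (ℤ→ℚ (f j)) (λ σⱼ≡0 → Sig≡0⇒block≡0 F≥0 j n σⱼ≡0 t))) ⟩
      σᵢ⁻¹ * (b * (σ j * inv (σ j) * ℤ→ℚ (f j)))
        ≡⟨ solve 5 (λ c b s s⁻¹ w → c :* (b :* (s :* s⁻¹ :* w)) := s :* c :* (b :* (s⁻¹ :* w)))
                 refl σᵢ⁻¹ b (σ j) (inv (σ j)) (ℤ→ℚ (f j)) ⟩
      σ j * σᵢ⁻¹ * (b * (inv (σ j) * ℤ→ℚ (f j))) ∎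
      where
      b : ℚ
      b = ℤ→ℚ (B a i j)

  atom-recurrence : IsRepresentation k F B → (∀ i m → 0ℤ ℤ.≤ F i m) →
    ∀ n i (t : Fin (blockLength n)) (a : Fin k) y →
    atomMass (atom (suc n) i (toℕ t ℕ.* k ℕ.+ toℕ a)) y ≡ ∑ (λ j → contribution n i y j a (toℕ t))
  atom-recurrence rep F≥0 n i t a y = begin
    proj₂ (atom (suc n) i m) * δ-mass (ℕ→ℚ m * spacing (suc n)) y
      ≡⟨ cong₂ (λ w x → w * δ-mass x y) (atom-weight rep F≥0 n i t a) (atom-position n (toℕ t) (toℕ a)) ⟩
    ∑ (λ j → ratio n i j * w j) * δ-at
      ≡⟨ *-distribʳ-∑ δ-at (λ j → ratio n i j * w j) ⟩
    ∑ (λ j → ratio n i j * w j * δ-at)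
      ≡⟨ ∑-cong (λ j → ℚP.*-assoc (ratio n i j) (w j) δ-at) ⟩
    ∑ (λ j → ratio n i j * (w j * δ-at)) ∎
    where
    m : ℕ
    m = toℕ t ℕ.* k ℕ.+ toℕ a
    δ-at : ℚ
    δ-at = δ-mass (ℕ→ℚ (toℕ a) * spacing (suc n) + ℕ→ℚ (toℕ t) * spacing n) y
    w : Fin d → ℚ
    w j = ℤ→ℚ (B a i j) * proj₂ (atom n j (toℕ t))

  massAt-Aμ : ∀ n i y → massAt (Aμ k F B (suc n) i) y ≡
                        ∑ (λ j → ∑ (λ a → ∑< (blockLength n) (contribution n i y j a)))
  massAt-Aμ n i y = trans (massAt-∑ₘ {d} _ y) (∑-cong λ j → begin
    massAt (ratio n i j ·ₘ (polyδ (λ a → B a i j) (spacing (suc n)) ∗ μ k F B n j)) y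
      ≡⟨ massAt-·ₘ (ratio n i j) (polyδ (λ a → B a i j) (spacing (suc n)) ∗ μ k F B n j) y ⟩
    ratio n i j * massAt (polyδ (λ a → B a i j) (spacing (suc n)) ∗ μ k F B n j) y
      ≡⟨ cong (ratio n i j *_) (massAt-polyδ-∗ (λ a → B a i j) (spacing (suc n)) (μ k F B n j) y) ⟩
    ratio n i j * ∑ (λ a → massAt (map (translate (polyAtom (suc n) i j a)) (μ k F B n j)) y)
      ≡⟨ cong (ratio n i j *_) (∑-cong (λ a → massAt-map-μ n j (translate (polyAtom (suc n) i j a)) y)) ⟩
    ratio n i j * ∑ (λ a → ∑< (blockLength n) (translatedMass j a))
      ≡⟨ *-distribˡ-∑ (ratio n i j) (λ a → ∑< (blockLength n) (translatedMass j a)) ⟩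
    ∑ (λ a → ratio n i j * ∑< (blockLength n) (translatedMass j a))
      ≡⟨ ∑-cong (λ a → *-distribˡ-∑ {blockLength n} (ratio n i j) (translatedMass j a ∘ toℕ)) ⟩
    ∑ (λ a → ∑< (blockLength n) (contribution n i y j a)) ∎)
    where
    translatedMass : Fin d → Fin k → ℕ → ℚ
    translatedMass j a t = atomMass (translate (polyAtom (suc n) i j a) (atom n j t)) y

proposition3p3 : (k : ℕ) → 2 ≤ k → (d : ℕ) →
    (F : Fin (suc d) → ℕ → ℤ) → (B : Fin k → Fin (suc d) → Fin (suc d) → ℤ) →
    IsKernelBasis k (F zero) F → IsRepresentation k F B → IsPrimitive k (F zero) B →
    (n : ℕ) → 1 ≤ n → (i : Fin (suc d)) →
    μ k F B n i ≈ₘ Aμ k F B n i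
proposition3p3 k 2≤k d F B (inKernel , _) rep (f≥0 , _) (suc n) _ i y = begin
  massAt (μ k F B (suc n) i) y
    ≡⟨ massAt-map-upTo (blockLength (suc n)) (atom (suc n) i) y ⟩
  ∑< (blockLength (suc n)) mass
    ≡⟨ cong (λ N → ∑< N mass) (blockLength-suc n) ⟩
  ∑< (blockLength n ℕ.* k) mass
    ≡⟨ ∑<-* (blockLength n) k mass ⟩
  ∑< (blockLength n) (λ t → ∑ {k} (λ a → mass (t ℕ.* k ℕ.+ toℕ a)))
    ≡⟨ ∑-cong (λ t → ∑-cong (λ a → atom-recurrence rep F≥0 n i t a y)) ⟩
  ∑< (blockLength n) (λ t → ∑ {k} (λ a → ∑ (λ j → contribution n i y j a t)))
    ≡⟨ ∑-rotate₃ {blockLength n} (λ t a j → contribution n i y j a (toℕ t)) ⟩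
  ∑ (λ j → ∑ (λ a → ∑< (blockLength n) (contribution n i y j a)))
    ≡⟨ sym (massAt-Aμ n i y) ⟩
  massAt (Aμ k F B (suc n) i) y ∎
  where
  open Measures k 2≤k F B

  mass : ℕ → ℚ
  mass m = atomMass (atom (suc n) i m) y

  F≥0 : ∀ j m → 0ℤ ℤ.≤ F j m
  F≥0 j = kernel-nonNeg (inKernel j) f≥0
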